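{- Let $m$ be a positive integer and let $B=(b_1,\dots,b_n)$ be any Ferrers board. Then, as polynomials in $x$, $$ \sum_{k=0}^n r_{k,m}(B)\, x\downarrow_{n-k,m} = \prod_{j=1}^n \begin{cases} x+\lfloor b_j \rfloor_m -(j-1)m + \rho_m(z) &\text{if $j$ is the last index in its $m$-zone $z$,}\\ x+\lfloor b_j \rfloor_m -(j-1)m &\text{otherwise.} \end{cases} $$
   Context: The first quadrant is tiled by unit cells; a cell is given the coordinates $(i,j)$ of its northeast corner, so $i$ is its column and $j$ its row. A Ferrers board $B=(b_1,\dots,b_n)$, where $0\le b_1\le\dots\le b_n$ are integers, is the set of cells consisting of the $b_j$ lowest cells of column $j$, $1\le j\le n$. Fix a positive integer $m$. The $i$th level consists of rows $(i-1)m+1,\dots,im$. An $m$-level rook placement on $B$ is a subset $P\subseteq B$ no two of whose cells (rooks) lie in the same level or in the same column; $r_{k,m}(B)$ is the number of $m$-level rook placements on $B$ with $k$ rooks. The $m$-falling factorial is $x\downarrow_{n,m}=x(x-m)(x-2m)\cdots(x-(n-1)m)$ (equal to $1$ if $n=0$). For an integer $n$, $\lfloor n\rfloor_m$ is the largest multiple of $m$ that is $\le n$, and $\rho_m(n)=n-\lfloor n\rfloor_m$. An $m$-zone of $B$ is a maximal interval $z=[s,t]=\{s,s+1,\dots,t\}$ of column indices with $\lfloor b_s\rfloor_m=\lfloor b_{s+1}\rfloor_m=\dots=\lfloor b_t\rfloor_m$; its $m$-remainder is $\rho_m(z)=\sum_{j\in z}\rho_m(b_j)$. -}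

module Defs where

open import Data.Nat as ℕ using (ℕ; zero; suc; _∸_; NonZero)
open import Data.Nat.DivMod using (_/_; _%_)
open import Data.Integer as ℤ using (ℤ; +_)
open import Data.List using (List; []; _∷_; _++_; map; length; filter; upTo; concatMap; foldr)
open import Data.List.Relation.Unary.AllPairs using (AllPairs)
open import Data.List.Relation.Unary.AllPairs.Properties using ()
import Data.List.Relation.Unary.AllPairs as AP
open import Data.Product using (_×_; _,_)
open import Relation.Binary.PropositionalEquality using (_≡_; _≢_)
open import Relation.Nullary using (Dec; ¬?)
open import Relation.Nullary.Decidable using (_×-dec_)
open import Data.Bool using (if_then_else_)
open import Data.Nat using (_≡ᵇ_)

⌊_⌋[_] : ℕ → (m : ℕ) → .{{NonZero m}} → ℕ
⌊ n ⌋[ m ] = (n / m) ℕ.* m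

ρ[_] : (m : ℕ) → .{{NonZero m}} → ℕ → ℕ
ρ[ m ] n = n % m

fall : ℤ → ℕ → ℕ → ℤ
fall x zero    m = ℤ.+ 1
fall x (suc n) m = x ℤ.* fall (x ℤ.- (+ m)) n m

-- A cell (i , j) : column i, row j (1-based, coordinates of NE corner).
Cell : Set
Cell = ℕ × ℕ

columnCells : ℕ → ℕ → List Cell
columnCells i h = map (λ r → (i , suc r)) (upTo h)

boardCellsFrom : ℕ → List ℕ → List Cell
boardCellsFrom i []       = []
boardCellsFrom i (b ∷ bs) = columnCells i b ++ boardCellsFrom (suc i) bs

boardCells : List ℕ → List Cell
boardCells = boardCellsFrom 1

-- level of row r (r ≥ 1): rows (l-1)m+1 .. lm form level l; we use index l-1
level : (m : ℕ) → .{{NonZero m}} → ℕ → ℕ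
level m r = (r ∸ 1) / m

NonAttacking : (m : ℕ) → .{{NonZero m}} → Cell → Cell → Set
NonAttacking m (i , r) (i' , r') = (i ≢ i') × (level m r ≢ level m r')

nonAttacking? : (m : ℕ) → .{{_ : NonZero m}} → (c d : Cell) → Dec (NonAttacking m c d)
nonAttacking? m (i , r) (i' , r') = ¬? (i ℕ.≟ i') ×-dec ¬? (level m r ℕ.≟ level m r')

subsets : {A : Set} → List A → List (List A)
subsets []       = [] ∷ []
subsets (x ∷ xs) = subsets xs ++ map (x ∷_) (subsets xs)

IsPlacement : (m : ℕ) → .{{NonZero m}} → List Cell → Set
IsPlacement m P = AllPairs (NonAttacking m) P

rook : (m : ℕ) → .{{NonZero m}} → ℕ → List ℕ → ℕ
rook m k B = length (filter (λ P → (length P ℕ.≟ k) ×-dec AP.allPairs? (nonAttacking? m) P)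
                           (subsets (boardCells B)))

sumℤ : List ℤ → ℤ
sumℤ = foldr ℤ._+_ (+ 0)

lhs : (m : ℕ) → .{{NonZero m}} → List ℕ → ℤ → ℤ
lhs m B x = sumℤ (map (λ k → (+ rook m k B) ℤ.* fall x (length B ∸ k) m) (upTo (suc (length B))))

-- RHS product.  prodFrom m x i acc bs: bs = (b_{i+1}, ..., b_n) (so the head has
-- column index j = i+1, and (j-1)m = i m); acc = sum of ρ_m(b) over the earlier
-- columns of the current m-zone (the maximal run of consecutive columns with equal ⌊b⌋_m).
-- A column is the last of its zone iff it is the last column or the next column
-- has a different ⌊b⌋_m.
factor : (m : ℕ) → .{{NonZero m}} → ℤ → ℕ → ℕ → ℤ
factor m x i b = x ℤ.+ (+ ⌊ b ⌋[ m ]) ℤ.- (+ (i ℕ.* m))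

prodFrom : (m : ℕ) → .{{NonZero m}} → ℤ → ℕ → ℕ → List ℕ → ℤ
prodFrom m x i acc []            = + 1
prodFrom m x i acc (b ∷ [])      = factor m x i b ℤ.+ (+ (acc ℕ.+ ρ[ m ] b))
prodFrom m x i acc (b ∷ c ∷ bs) =
  if ⌊ b ⌋[ m ] ≡ᵇ ⌊ c ⌋[ m ]
  then factor m x i b ℤ.* prodFrom m x (suc i) (acc ℕ.+ ρ[ m ] b) (c ∷ bs)
  else (factor m x i b ℤ.+ (+ (acc ℕ.+ ρ[ m ] b))) ℤ.* prodFrom m x (suc i) 0 (c ∷ bs)

rhs : (m : ℕ) → .{{NonZero m}} → List ℕ → ℤ → ℤ
rhs m B x = prodFrom m x 0 0 B

module Submission where

-- Both sides are generalized by a list U of levels that are already occupied.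
-- (1) The number rookCount B U k of k-rook placements on B avoiding U obeys a recursion on
--     the first column b: it is empty, or holds one rook in a free row r + 1, which then
--     occupies level r / m as well (module Placements, rook≡rookCount).
-- (2) Hence rookPoly B U x = Σ_k rookCount B U k · x↓_{|B|−k,m} satisfies
--     rookPoly (b ∷ B) U x = x · rookPoly B U (x − m) + Σ_{r < b, r/m ∉ U} rookPoly B (r/m ∷ U) x,
--     by x↓_{n+1,m} = x · (x − m)↓_{n,m} (rookPoly-∷).
-- (3) The rows of column b form b / m full levels and b % m rows of level b / m (Σ-rows);
--     the full levels outside U are counted by freeLevels.
-- (4) For weakly increasing B and distinct U with no level above that of the first column,
--     rookPoly B U x is the product of the theorem with column offset |U|, or a variant
--     blockedProd when the first zone's level lies in U (rookPoly-closed, by induction on B).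
--     It rests on two facts about the products: lowering x by m is shifting the column
--     index, and the last factor of a zone is affine in the accumulated remainder, with a
--     slope that telescopes into blockedProd (prodFrom-acc).
-- For U = [] the closed form is the right-hand side, which proves the theorem.

open import Data.Nat using (ℕ; _≤_; NonZero)
open import Data.Integer using (ℤ)
open import Data.List using (List)
open import Data.List.Relation.Unary.Linked using (Linked)
open import Relation.Binary.PropositionalEquality using (_≡_)

open import Defs
open import Data.Bool using (Bool; true; false; if_then_else_; _∨_)
open import Data.Bool.Properties using (if-not; if-cong₂)
open import Data.Nat as ℕ using (zero; suc; _<_; z≤n; s≤s; _≟_)
import Data.Nat.Properties as ℕP
open import Data.Nat.DivMod using (_/_; _%_; m≡m%n+[m/n]*n; m<n⇒m/n≡0; m/n≡1+[m∸n]/n; m%n<n; /-monoˡ-≤)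
open import Data.Integer using (+_; _+_; _*_; _-_)
import Data.Integer.Properties as ℤP
open import Data.Integer.Tactic.RingSolver using (solve-∀)
open import Data.List using ([]; _∷_; _++_; map; length; filter; upTo; applyUpTo)
open import Data.Nat.ListAction using (sum)
import Data.List.Properties as ListP
open import Data.List.Membership.Propositional using (_∈_; _∉_)
open import Data.List.Membership.Propositional.Properties using (∈-map⁺; ∈-map⁻)
open import Data.List.Membership.DecPropositional _≟_ using (_∈?_)
open import Data.List.Relation.Unary.All as All using (All; []; _∷_)
import Data.List.Relation.Unary.All.Properties as AllP
open import Data.List.Relation.Unary.AllPairs using ([]; _∷_)
open import Data.List.Relation.Unary.Linked using (_∷_)
open import Data.List.Relation.Unary.Unique.Propositional using (Unique)
import Data.List.Relation.Unary.AllPairs as AllPairs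
open import Data.Product using (_×_; _,_; proj₁; proj₂)
open import Function using (_∘_; _⇔_; mk⇔)
open import Relation.Binary.PropositionalEquality using (_≢_; refl; sym; trans; cong; cong₂; subst; module ≡-Reasoning)
open import Relation.Nullary using (Dec; yes; no; does; ¬_; ¬?)
open import Relation.Nullary.Decidable using (_×-dec_; does-⇔; dec-true; dec-false)
open import Relation.Unary using (Pred; Decidable)
open import Level using (0ℓ)

Σℕ : ℕ → (ℕ → ℕ) → ℕ
Σℕ zero    f = 0
Σℕ (suc n) f = f 0 ℕ.+ Σℕ n (f ∘ suc)

Σℤ : ℕ → (ℕ → ℤ) → ℤ
Σℤ zero    f = + 0
Σℤ (suc n) f = f 0 + Σℤ n (f ∘ suc)

sum-applyUpTo : ∀ {A : Set} (f : A → ℕ) (g : ℕ → A) n → sum (map f (applyUpTo g n)) ≡ Σℕ n (f ∘ g)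
sum-applyUpTo f g zero    = refl
sum-applyUpTo f g (suc n) = cong (f (g 0) ℕ.+_) (sum-applyUpTo f (g ∘ suc) n)

sumℤ-applyUpTo : ∀ (f : ℕ → ℤ) (g : ℕ → ℕ) n → sumℤ (map f (applyUpTo g n)) ≡ Σℤ n (f ∘ g)
sumℤ-applyUpTo f g zero    = refl
sumℤ-applyUpTo f g (suc n) = cong (_+_ (f (g 0))) (sumℤ-applyUpTo f (g ∘ suc) n)

Σℕ-cong : ∀ n {f g : ℕ → ℕ} → (∀ k → k < n → f k ≡ g k) → Σℕ n f ≡ Σℕ n g
Σℕ-cong zero    eq = refl
Σℕ-cong (suc n) eq = cong₂ ℕ._+_ (eq 0 (s≤s z≤n)) (Σℕ-cong n (λ k k<n → eq (suc k) (s≤s k<n)))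

Σℕ-zero : ∀ n (f : ℕ → ℕ) → (∀ k → k < n → f k ≡ 0) → Σℕ n f ≡ 0
Σℕ-zero zero    f eq = refl
Σℕ-zero (suc n) f eq rewrite eq 0 (s≤s z≤n) = Σℕ-zero n (f ∘ suc) (λ k k<n → eq (suc k) (s≤s k<n))

Σℤ-cong : ∀ n {f g : ℕ → ℤ} → (∀ k → k < n → f k ≡ g k) → Σℤ n f ≡ Σℤ n g
Σℤ-cong zero    eq = refl
Σℤ-cong (suc n) eq = cong₂ _+_ (eq 0 (s≤s z≤n)) (Σℤ-cong n (λ k k<n → eq (suc k) (s≤s k<n)))

Σℤ-pos : ∀ n (f : ℕ → ℕ) → + Σℕ n f ≡ Σℤ n (λ k → + f k)
Σℤ-pos zero    f = refl
Σℤ-pos (suc n) f = trans (ℤP.pos-+ (f 0) _) (cong (_+_ (+ f 0)) (Σℤ-pos n (f ∘ suc)))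

Σℤ-+ : ∀ n (f g : ℕ → ℤ) → Σℤ n (λ k → f k + g k) ≡ Σℤ n f + Σℤ n g
Σℤ-+ zero    f g = refl
Σℤ-+ (suc n) f g rewrite Σℤ-+ n (f ∘ suc) (g ∘ suc) = shuffle (f 0) (g 0) _ _
  where shuffle : ∀ a b c d → a + b + (c + d) ≡ a + c + (b + d)
        shuffle = solve-∀

Σℤ-*ˡ : ∀ n c (f : ℕ → ℤ) → Σℤ n (λ k → c * f k) ≡ c * Σℤ n f
Σℤ-*ˡ zero    c f = sym (ℤP.*-zeroʳ c)
Σℤ-*ˡ (suc n) c f rewrite Σℤ-*ˡ n c (f ∘ suc) = sym (ℤP.*-distribˡ-+ c (f 0) _)

Σℤ-*ʳ : ∀ n c (f : ℕ → ℤ) → Σℤ n (λ k → f k * c) ≡ Σℤ n f * c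
Σℤ-*ʳ n c f = trans (Σℤ-cong n (λ k _ → ℤP.*-comm (f k) c)) (trans (Σℤ-*ˡ n c f) (ℤP.*-comm c _))

Σℤ-const : ∀ n c → Σℤ n (λ _ → c) ≡ + n * c
Σℤ-const zero    c = sym (ℤP.*-zeroˡ c)
Σℤ-const (suc n) c rewrite Σℤ-const n c = one-more c (+ n)
  where one-more : ∀ c n → c + n * c ≡ (+ 1 + n) * c
        one-more = solve-∀

Σℤ-zero : ∀ n → Σℤ n (λ _ → + 0) ≡ + 0
Σℤ-zero n = trans (Σℤ-const n (+ 0)) (ℤP.*-zeroʳ (+ n))

Σℤ-snoc : ∀ n (f : ℕ → ℤ) → Σℤ (suc n) f ≡ Σℤ n f + f n
Σℤ-snoc zero    f = trans (ℤP.+-identityʳ (f 0)) (sym (ℤP.+-identityˡ (f 0)))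
Σℤ-snoc (suc n) f rewrite Σℤ-snoc n (f ∘ suc) = sym (ℤP.+-assoc (f 0) _ _)

Σℤ-split : ∀ a b (f : ℕ → ℤ) → Σℤ (a ℕ.+ b) f ≡ Σℤ a f + Σℤ b (λ k → f (a ℕ.+ k))
Σℤ-split zero    b f = sym (ℤP.+-identityˡ _)
Σℤ-split (suc a) b f rewrite Σℤ-split a b (f ∘ suc) = sym (ℤP.+-assoc (f 0) _ _)

Σℤ-swap : ∀ n p (f : ℕ → ℕ → ℤ) → Σℤ n (λ k → Σℤ p (f k)) ≡ Σℤ p (λ r → Σℤ n (λ k → f k r))
Σℤ-swap zero    p f = sym (Σℤ-zero p)
Σℤ-swap (suc n) p f rewrite Σℤ-swap n p (f ∘ suc) = sym (Σℤ-+ p (f 0) _)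

Σℤ-if : ∀ n (M : Bool) (f : ℕ → ℤ) → Σℤ n (λ k → if M then + 0 else f k) ≡ (if M then + 0 else Σℤ n f)
Σℤ-if n true  f = Σℤ-zero n
Σℤ-if n false f = refl

module _ {A : Set} {P : Pred A 0ℓ} (P? : Decidable P) where

  length-filter-++ : ∀ xs ys → length (filter P? (xs ++ ys)) ≡ length (filter P? xs) ℕ.+ length (filter P? ys)
  length-filter-++ xs ys = trans (cong length (ListP.filter-++ P? xs ys)) (ListP.length-++ (filter P? xs))

  length-filter-map : ∀ {B : Set} (f : B → A) xs → length (filter P? (map f xs)) ≡ length (filter (P? ∘ f) xs)
  length-filter-map f []       = refl
  length-filter-map f (x ∷ xs) with does (P? (f x))
  ... | true  = cong suc (length-filter-map f xs)
  ... | false = length-filter-map f xs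

sum-map-zero : ∀ {A : Set} (f : A → ℕ) xs → All (λ x → f x ≡ 0) xs → sum (map f xs) ≡ 0
sum-map-zero f []       []         = refl
sum-map-zero f (x ∷ xs) (fx≡0 ∷ h) rewrite fx≡0 = sum-map-zero f xs h

-- Rook numbers of a Ferrers board satisfy a column-by-column recursion: the rooks
-- placed so far only matter through the set of levels they occupy.
module Placements (m : ℕ) .{{_ : NonZero m}} where

  NonAttacking-sym : ∀ {c d} → NonAttacking m c d → NonAttacking m d c
  NonAttacking-sym (i≢j , l≢l′) = i≢j ∘ sym , l≢l′ ∘ sym

  Compatible : Cell → List Cell → Set
  Compatible c F = All (NonAttacking m c) F

  compatible? : ∀ c F → Dec (Compatible c F)
  compatible? c F = All.all? (nonAttacking? m c) F

  Extends : List Cell → ℕ → List Cell → Set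
  Extends F k P = length P ≡ k × IsPlacement m P × All (λ p → Compatible p F) P

  extends? : ∀ F k → Decidable (Extends F k)
  extends? F k P = (length P ℕ.≟ k) ×-dec (AllPairs.allPairs? (nonAttacking? m) P ×-dec All.all? (λ p → compatible? p F) P)

  extensions : List Cell → List Cell → ℕ → ℕ
  extensions L F k = length (filter (extends? F k) (subsets L))

  rook≡extensions : ∀ k B → rook m k B ≡ extensions (boardCells B) [] k
  rook≡extensions k B = cong length (ListP.filter-≐ _ (extends? [] k)
    ((λ { (len , pl) → len , pl , All.universal (λ _ → []) _ }) , (λ { (len , pl , _) → len , pl }))
    (subsets (boardCells B)))

  extensions-∷ : ∀ c L F k → extensions (c ∷ L) F k ≡
    extensions L F k ℕ.+ length (filter (extends? F k ∘ (c ∷_)) (subsets L))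
  extensions-∷ c L F k = trans (length-filter-++ (extends? F k) (subsets L) _)
    (cong (extensions L F k ℕ.+_) (length-filter-map (extends? F k) (c ∷_) (subsets L)))

  extensions-zero : ∀ L F → extensions L F 0 ≡ 1
  extensions-zero []      F = refl
  extensions-zero (c ∷ L) F = trans (extensions-∷ c L F 0)
    (cong₂ ℕ._+_ (extensions-zero L F) (cong length (ListP.filter-none (extends? F 0 ∘ (c ∷_)) (All.universal (λ { _ (() , _) }) (subsets L)))))

  extensions-suc : ∀ c L F k → extensions (c ∷ L) F (suc k) ≡
    extensions L F (suc k) ℕ.+ (if does (compatible? c F) then extensions L (c ∷ F) k else 0)
  extensions-suc c L F k = trans (extensions-∷ c L F (suc k)) (cong (extensions L F (suc k) ℕ.+_) (containing-c (compatible? c F)))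
    where
    containing-c : (c? : Dec (Compatible c F)) → length (filter (extends? F (suc k) ∘ (c ∷_)) (subsets L)) ≡
      (if does c? then extensions L (c ∷ F) k else 0)
    containing-c (yes c-ok) = cong length (ListP.filter-≐ (extends? F (suc k) ∘ (c ∷_)) (extends? (c ∷ F) k) (to , from) (subsets L))
      where
      to : ∀ {P} → Extends F (suc k) (c ∷ P) → Extends (c ∷ F) k P
      to (len , (c-P ∷ pl) , (_ ∷ P-F)) =
        ℕP.suc-injective len , pl , All.zipWith (λ {p} (c-p , p-F) → NonAttacking-sym {c} {p} c-p ∷ p-F) (c-P , P-F)
      from : ∀ {P} → Extends (c ∷ F) k P → Extends F (suc k) (c ∷ P)
      from (len , pl , P-cF) =
        cong suc len , (All.map (λ {p} p-cF → NonAttacking-sym {p} {c} (All.head p-cF)) P-cF ∷ pl) , (c-ok ∷ All.map All.tail P-cF)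
    containing-c (no ¬c-ok) = cong length (ListP.filter-none (extends? F (suc k) ∘ (c ∷_))
      (All.universal (λ { _ (_ , _ , c-ok ∷ _) → ¬c-ok c-ok }) (subsets L)))

  -- Two rooks in one column attack each other, so a column X contributes at most one
  -- rook: a placement on X ++ R either avoids X or uses exactly one compatible cell of X.
  extensions-column : ∀ i X R F k → All (λ c → proj₁ c ≡ i) X →
    extensions (X ++ R) F (suc k) ≡
    extensions R F (suc k) ℕ.+ sum (map (λ c → if does (compatible? c F) then extensions R (c ∷ F) k else 0) X)
  extensions-column i []      R F k []          = sym (ℕP.+-identityʳ _)
  extensions-column i (c ∷ X) R F k (c∈i ∷ X∈i) = begin
      extensions (c ∷ X ++ R) F (suc k)
    ≡⟨ extensions-suc c (X ++ R) F k ⟩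
      extensions (X ++ R) F (suc k) ℕ.+ choose c (extensions (X ++ R) (c ∷ F) k)
    ≡⟨ cong₂ ℕ._+_ (extensions-column i X R F k X∈i) (cong (choose c) (only-c k)) ⟩
      extensions R F (suc k) ℕ.+ rest ℕ.+ choose c (extensions R (c ∷ F) k)
    ≡⟨ ℕP.+-assoc (extensions R F (suc k)) rest _ ⟩
      extensions R F (suc k) ℕ.+ (rest ℕ.+ choose c (extensions R (c ∷ F) k))
    ≡⟨ cong (extensions R F (suc k) ℕ.+_) (ℕP.+-comm rest _) ⟩
      extensions R F (suc k) ℕ.+ (choose c (extensions R (c ∷ F) k) ℕ.+ rest)
    ∎
    where
    open ≡-Reasoning
    choose : Cell → ℕ → ℕ
    choose d v = if does (compatible? d F) then v else 0
    rest : ℕ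
    rest = sum (map (λ d → choose d (extensions R (d ∷ F) k)) X)
    only-c : ∀ j → extensions (X ++ R) (c ∷ F) j ≡ extensions R (c ∷ F) j
    only-c zero    = trans (extensions-zero (X ++ R) (c ∷ F)) (sym (extensions-zero R (c ∷ F)))
    only-c (suc j) = trans (extensions-column i X R (c ∷ F) j X∈i)
      (trans (cong (extensions R (c ∷ F) (suc j) ℕ.+_) (sum-map-zero _ X (All.map blocked X∈i))) (ℕP.+-identityʳ _))
      where
      blocked : ∀ {d} → proj₁ d ≡ i → (if does (compatible? d (c ∷ F)) then extensions R (d ∷ c ∷ F) j else 0) ≡ 0
      blocked {d} d∈i = cong (λ b → if b then extensions R (d ∷ c ∷ F) j else 0)
        (dec-false (compatible? d (c ∷ F)) (λ { (d-c ∷ _) → proj₁ d-c (trans d∈i (sym c∈i)) }))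

  -- the (0-based) level of a cell; row r + 1 lies in level r / m
  cellLevel : Cell → ℕ
  cellLevel (_ , r) = level m r

  LeftOf : ℕ → List Cell → Set
  LeftOf i F = All (λ f → proj₁ f < i) F

  compatible⇔free : ∀ {i r F} → LeftOf i F → Compatible (i , suc r) F ⇔ (r / m ∉ map cellLevel F)
  compatible⇔free {i} {r} {F} left = mk⇔ to from
    where
    to : Compatible (i , suc r) F → r / m ∉ map cellLevel F
    to compat occupied with ∈-map⁻ cellLevel occupied
    ... | f , f∈F , same = proj₂ (All.lookup compat f∈F) same
    from : r / m ∉ map cellLevel F → Compatible (i , suc r) F
    from free = All.tabulate λ {f} f∈F →
      (λ same-col → ℕP.<-irrefl (sym same-col) (All.lookup left f∈F)) ,
      (λ same-lvl → free (subst (_∈ map cellLevel F) (sym same-lvl) (∈-map⁺ cellLevel f∈F)))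

  -- the number of placements of k rooks on the columns B (of any heights, taken from
  -- left to right) avoiding the levels U
  rookCount : List ℕ → List ℕ → ℕ → ℕ
  rookCount B       U zero    = 1
  rookCount []      U (suc k) = 0
  rookCount (b ∷ B) U (suc k) =
    rookCount B U (suc k) ℕ.+ Σℕ b (λ r → if does (r / m ∈? U) then 0 else rookCount B (r / m ∷ U) k)

  rookCount-big : ∀ B U k → length B < k → rookCount B U k ≡ 0
  rookCount-big []      U (suc k) _          = refl
  rookCount-big (b ∷ B) U (suc k) (s≤s n<k) =
    cong₂ ℕ._+_ (rookCount-big B U (suc k) (ℕP.m<n⇒m<1+n n<k))
      (Σℕ-zero b _ (λ r _ → none (does (r / m ∈? U)) (rookCount-big B (r / m ∷ U) k n<k)))
    where
    none : ∀ M {v} → v ≡ 0 → (if M then 0 else v) ≡ 0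
    none true  _   = refl
    none false v≡0 = v≡0

  extensions-board : ∀ B i F k → LeftOf i F → extensions (boardCellsFrom i B) F k ≡ rookCount B (map cellLevel F) k
  extensions-board B       i F zero    left = extensions-zero (boardCellsFrom i B) F
  extensions-board []      i F (suc k) left = refl
  extensions-board (b ∷ B) i F (suc k) left =
    trans (extensions-column i (columnCells i b) (boardCellsFrom (suc i) B) F k (AllP.map⁺ (All.universal (λ _ → refl) (upTo b))))
      (cong₂ ℕ._+_ (extensions-board B (suc i) F (suc k) left′)
        (trans (cong sum (sym (ListP.map-∘ (upTo b))))
          (trans (sum-applyUpTo _ (λ r → r) b) (Σℕ-cong b (λ r _ → row r)))))
    where
    left′ : LeftOf (suc i) F
    left′ = All.map ℕP.m<n⇒m<1+n left
    row : ∀ r → (if does (compatible? (i , suc r) F) then extensions (boardCellsFrom (suc i) B) ((i , suc r) ∷ F) k else 0)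
              ≡ (if does (r / m ∈? map cellLevel F) then 0 else rookCount B (r / m ∷ map cellLevel F) k)
    row r = trans (cong₂ (λ M v → if M then v else 0) (does-⇔ (compatible⇔free left) (compatible? (i , suc r) F) (¬? (r / m ∈? map cellLevel F)))
                         (extensions-board B (suc i) ((i , suc r) ∷ F) k (ℕP.n<1+n i ∷ left′)))
                  (if-not (does (r / m ∈? map cellLevel F)))

  rook≡rookCount : ∀ k B → rook m k B ≡ rookCount B [] k
  rook≡rookCount k B = trans (rook≡extensions k B) (extensions-board B 1 [] k [])

  rookPoly : List ℕ → List ℕ → ℤ → ℤ
  rookPoly B U x = Σℤ (suc (length B)) (λ k → + rookCount B U k * fall x (length B ℕ.∸ k) m)

  lhs≡rookPoly : ∀ B x → lhs m B x ≡ rookPoly B [] x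
  lhs≡rookPoly B x = trans (sumℤ-applyUpTo (λ k → + rook m k B * fall x (length B ℕ.∸ k) m) (λ k → k) (suc (length B)))
    (Σℤ-cong (suc (length B)) (λ k _ → cong (λ c → + c * fall x (length B ℕ.∸ k) m) (rook≡rookCount k B)))

  -- Placements leaving the first column empty: since x↓_{n+1−k,m} = x · (x−m)↓_{n−k,m}
  -- for k ≤ n, they contribute x times the polynomial of the remaining columns at x − m.
  emptyFirstColumn : ∀ B U x → let n = length B in
    Σℤ (suc (suc n)) (λ k → + rookCount B U k * fall x (suc n ℕ.∸ k) m) ≡ x * rookPoly B U (x - + m)
  emptyFirstColumn B U x = begin
      Σℤ (suc (suc n)) term
    ≡⟨ Σℤ-snoc (suc n) term ⟩
      Σℤ (suc n) term + + rookCount B U (suc n) * fall x (n ℕ.∸ n) m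
    ≡⟨ cong (λ c → Σℤ (suc n) term + + c * fall x (n ℕ.∸ n) m) (rookCount-big B U (suc n) (ℕP.n<1+n n)) ⟩
      Σℤ (suc n) term + + 0 * fall x (n ℕ.∸ n) m
    ≡⟨ trans (cong (_+_ (Σℤ (suc n) term)) (ℤP.*-zeroˡ (fall x (n ℕ.∸ n) m))) (ℤP.+-identityʳ (Σℤ (suc n) term)) ⟩
      Σℤ (suc n) term
    ≡⟨ Σℤ-cong (suc n) (λ k k≤n → pull-x k (ℕP.≤-pred k≤n)) ⟩
      Σℤ (suc n) (λ k → x * (+ rookCount B U k * fall (x - + m) (n ℕ.∸ k) m))
    ≡⟨ Σℤ-*ˡ (suc n) x (λ k → + rookCount B U k * fall (x - + m) (n ℕ.∸ k) m) ⟩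
      x * rookPoly B U (x - + m)
    ∎
    where
    open ≡-Reasoning
    n = length B
    term : ℕ → ℤ
    term k = + rookCount B U k * fall x (suc n ℕ.∸ k) m
    pull-x : ∀ k → k ≤ n → term k ≡ x * (+ rookCount B U k * fall (x - + m) (n ℕ.∸ k) m)
    pull-x k k≤n rewrite ℕP.+-∸-assoc 1 k≤n = swap (+ rookCount B U k) x _
      where swap : ∀ c x f → c * (x * f) ≡ x * (c * f)
            swap = solve-∀

  withRookIn : List ℕ → List ℕ → ℕ → ℕ → ℕ
  withRookIn B U k r = if does (r / m ∈? U) then 0 else rookCount B (r / m ∷ U) k

  occupiedFirstColumn : ∀ b B U x → let n = length B in
    Σℤ (suc n) (λ k → + Σℕ b (withRookIn B U k) * fall x (n ℕ.∸ k) m) ≡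
    Σℤ b (λ r → if does (r / m ∈? U) then + 0 else rookPoly B (r / m ∷ U) x)
  occupiedFirstColumn b B U x = begin
      Σℤ (suc n) (λ k → + Σℕ b (withRookIn B U k) * f k)
    ≡⟨ Σℤ-cong (suc n) (λ k _ → trans (cong (_* f k) (Σℤ-pos b (withRookIn B U k)))
                                       (sym (Σℤ-*ʳ b (f k) (λ r → + withRookIn B U k r)))) ⟩
      Σℤ (suc n) (λ k → Σℤ b (λ r → + withRookIn B U k r * f k))
    ≡⟨ Σℤ-swap (suc n) b (λ k r → + withRookIn B U k r * f k) ⟩
      Σℤ b (λ r → Σℤ (suc n) (λ k → + withRookIn B U k r * f k))
    ≡⟨ Σℤ-cong b (λ r _ → trans (Σℤ-cong (suc n) (λ k _ → unless-* (does (r / m ∈? U)) (rookCount B (r / m ∷ U) k) (f k)))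
                                (Σℤ-if (suc n) (does (r / m ∈? U)) (λ k → + rookCount B (r / m ∷ U) k * f k))) ⟩
      Σℤ b (λ r → if does (r / m ∈? U) then + 0 else rookPoly B (r / m ∷ U) x)
    ∎
    where
    open ≡-Reasoning
    n = length B
    f : ℕ → ℤ
    f k = fall x (n ℕ.∸ k) m
    unless-* : ∀ M c z → + (if M then 0 else c) * z ≡ (if M then + 0 else + c * z)
    unless-* true  c z = ℤP.*-zeroˡ z
    unless-* false c z = refl

  rookPoly-∷ : ∀ b B U x → rookPoly (b ∷ B) U x ≡
    x * rookPoly B U (x - + m) + Σℤ b (λ r → if does (r / m ∈? U) then + 0 else rookPoly B (r / m ∷ U) x)
  rookPoly-∷ b B U x = begin
      rookPoly (b ∷ B) U x
    ≡⟨⟩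
      + 1 * fall x (suc n) m + Σℤ (suc n) (λ k → + (rookCount B U (suc k) ℕ.+ Σℕ b (withRookIn B U k)) * f k)
    ≡⟨ cong (_+_ (+ 1 * fall x (suc n) m)) (trans (Σℤ-cong (suc n) (λ k _ → split k)) (Σℤ-+ (suc n) empty occupied)) ⟩
      + 1 * fall x (suc n) m + (Σℤ (suc n) empty + Σℤ (suc n) occupied)
    ≡⟨ sym (ℤP.+-assoc (+ 1 * fall x (suc n) m) (Σℤ (suc n) empty) (Σℤ (suc n) occupied)) ⟩
      Σℤ (suc (suc n)) (λ k → + rookCount B U k * fall x (suc n ℕ.∸ k) m) + Σℤ (suc n) occupied
    ≡⟨ cong₂ _+_ (emptyFirstColumn B U x) (occupiedFirstColumn b B U x) ⟩
      x * rookPoly B U (x - + m) + Σℤ b (λ r → if does (r / m ∈? U) then + 0 else rookPoly B (r / m ∷ U) x)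
    ∎
    where
    open ≡-Reasoning
    n = length B
    f : ℕ → ℤ
    f k = fall x (n ℕ.∸ k) m
    empty occupied : ℕ → ℤ
    empty k = + rookCount B U (suc k) * f k
    occupied k = + Σℕ b (withRookIn B U k) * f k
    split : ∀ k → + (rookCount B U (suc k) ℕ.+ Σℕ b (withRookIn B U k)) * f k ≡ empty k + occupied k
    split k = trans (cong (_* f k) (ℤP.pos-+ (rookCount B U (suc k)) _)) (ℤP.*-distribʳ-+ (f k) (+ rookCount B U (suc k)) (+ Σℕ b (withRookIn B U k)))

Σℤ-indicator : ∀ N a V → a < N → Σℤ N (λ l → if does (l ≟ a) then V else + 0) ≡ V
Σℤ-indicator (suc N) zero    V _         = trans (cong (_+_ V) (Σℤ-zero N)) (ℤP.+-identityʳ V)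
Σℤ-indicator (suc N) (suc a) V (s≤s a<N) = trans (ℤP.+-identityˡ _) (Σℤ-indicator N a V a<N)

Σℤ-members : ∀ U N V → Unique U → All (_< N) U → Σℤ N (λ l → if does (l ∈? U) then V else + 0) ≡ + length U * V
Σℤ-members []      N V _             _           = trans (Σℤ-zero N) (sym (ℤP.*-zeroˡ V))
Σℤ-members (a ∷ U) N V (a∉U ∷ uniq) (a<N ∷ U<N) = begin
    Σℤ N (λ l → if does (l ≟ a) ∨ does (l ∈? U) then V else + 0)
  ≡⟨ Σℤ-cong N (λ l _ → split l (l ≟ a)) ⟩
    Σℤ N (λ l → (if does (l ≟ a) then V else + 0) + (if does (l ∈? U) then V else + 0))
  ≡⟨ Σℤ-+ N _ _ ⟩
    Σℤ N (λ l → if does (l ≟ a) then V else + 0) + Σℤ N (λ l → if does (l ∈? U) then V else + 0)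
  ≡⟨ cong₂ _+_ (Σℤ-indicator N a V a<N) (Σℤ-members U N V uniq U<N) ⟩
    V + + length U * V
  ≡⟨ cong (_+ + length U * V) (sym (ℤP.*-identityˡ V)) ⟩
    + 1 * V + + length U * V
  ≡⟨ sym (ℤP.*-distribʳ-+ V (+ 1) (+ length U)) ⟩
    + length (a ∷ U) * V
  ∎
  where
  open ≡-Reasoning
  split : ∀ l (l≟a : Dec (l ≡ a)) → (if does l≟a ∨ does (l ∈? U) then V else + 0) ≡
                (if does l≟a then V else + 0) + (if does (l ∈? U) then V else + 0)
  split l (yes refl) rewrite dec-false (l ∈? U) (AllP.All¬⇒¬Any a∉U) = sym (ℤP.+-identityʳ V)
  split l (no _)     = sym (ℤP.+-identityˡ _)

freeLevels : ∀ U q V → Unique U → All (_≤ q) U →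
  Σℤ q (λ l → if does (l ∈? U) then + 0 else V) + + length U * V ≡ + q * V + (if does (q ∈? U) then V else + 0)
freeLevels U q V uniq U≤q = begin
    Σℤ q free + + length U * V
  ≡⟨ cong (_+_ (Σℤ q free)) (sym (Σℤ-members U (suc q) V uniq (All.map s≤s U≤q))) ⟩
    Σℤ q free + Σℤ (suc q) used
  ≡⟨ cong (_+_ (Σℤ q free)) (Σℤ-snoc q used) ⟩
    Σℤ q free + (Σℤ q used + used q)
  ≡⟨ sym (ℤP.+-assoc (Σℤ q free) (Σℤ q used) (used q)) ⟩
    Σℤ q free + Σℤ q used + used q
  ≡⟨ cong (_+ used q) (trans (sym (Σℤ-+ q free used)) (trans (Σℤ-cong q (λ l _ → free+used (does (l ∈? U)))) (Σℤ-const q V))) ⟩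
    + q * V + used q
  ∎
  where
  open ≡-Reasoning
  free used : ℕ → ℤ
  free l = if does (l ∈? U) then + 0 else V
  used l = if does (l ∈? U) then V else + 0
  free+used : ∀ M → (if M then + 0 else V) + (if M then V else + 0) ≡ V
  free+used true  = ℤP.+-identityˡ V
  free+used false = ℤP.+-identityʳ V

module Rows (m : ℕ) .{{_ : NonZero m}} where

  [m+r]/m≡1+r/m : ∀ r → (m ℕ.+ r) / m ≡ suc (r / m)
  [m+r]/m≡1+r/m r = trans (m/n≡1+[m∸n]/n (ℕP.m≤m+n m r)) (cong (λ s → suc (s / m)) (ℕP.m+n∸m≡n m r))

  Σ-lowest : ∀ k (h : ℕ → ℤ) → k ≤ m → Σℤ k (λ r → h (r / m)) ≡ + k * h 0
  Σ-lowest k h k≤m = trans (Σℤ-cong k (λ r r<k → cong h (m<n⇒m/n≡0 (ℕP.<-≤-trans r<k k≤m)))) (Σℤ-const k (h 0))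

  Σ-blocks : ∀ q k (h : ℕ → ℤ) → k < m → Σℤ (q ℕ.* m ℕ.+ k) (λ r → h (r / m)) ≡ + m * Σℤ q h + + k * h q
  Σ-blocks zero k h k<m =
    trans (Σ-lowest k h (ℕP.<⇒≤ k<m)) (sym (trans (cong (_+ + k * h 0) (ℤP.*-zeroʳ (+ m))) (ℤP.+-identityˡ (+ k * h 0))))
  Σ-blocks (suc q) k h k<m = begin
      Σℤ (m ℕ.+ q ℕ.* m ℕ.+ k) (λ r → h (r / m))
    ≡⟨ cong (λ n → Σℤ n (λ r → h (r / m))) (ℕP.+-assoc m (q ℕ.* m) k) ⟩
      Σℤ (m ℕ.+ (q ℕ.* m ℕ.+ k)) (λ r → h (r / m))
    ≡⟨ Σℤ-split m (q ℕ.* m ℕ.+ k) (λ r → h (r / m)) ⟩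
      Σℤ m (λ r → h (r / m)) + Σℤ (q ℕ.* m ℕ.+ k) (λ r → h ((m ℕ.+ r) / m))
    ≡⟨ cong₂ _+_ (Σ-lowest m h ℕP.≤-refl) (Σℤ-cong (q ℕ.* m ℕ.+ k) (λ r _ → cong h ([m+r]/m≡1+r/m r))) ⟩
      + m * h 0 + Σℤ (q ℕ.* m ℕ.+ k) (λ r → h (suc (r / m)))
    ≡⟨ cong (_+_ (+ m * h 0)) (Σ-blocks q k (h ∘ suc) k<m) ⟩
      + m * h 0 + (+ m * Σℤ q (h ∘ suc) + + k * h (suc q))
    ≡⟨ regroup (+ m) (h 0) (Σℤ q (h ∘ suc)) (+ k * h (suc q)) ⟩
      + m * Σℤ (suc q) h + + k * h (suc q)
    ∎
    where
    open ≡-Reasoning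
    regroup : ∀ M h₀ s c → M * h₀ + (M * s + c) ≡ M * (h₀ + s) + c
    regroup = solve-∀

  Σ-rows : ∀ b (h : ℕ → ℤ) → Σℤ b (λ r → h (r / m)) ≡ + m * Σℤ (b / m) h + + (b % m) * h (b / m)
  Σ-rows b h = trans (cong (λ n → Σℤ n (λ r → h (r / m))) b≡q*m+ρ) (Σ-blocks (b / m) (b % m) h (m%n<n b m))
    where b≡q*m+ρ : b ≡ b / m ℕ.* m ℕ.+ b % m
          b≡q*m+ρ = trans (m≡m%n+[m/n]*n b m) (ℕP.+-comm (b % m) _)

module ZoneProducts (m : ℕ) .{{_ : NonZero m}} where

  -- The variant of the product used when the level ⌊b⌋/m of the first zone is already
  -- occupied: that zone's columns gain nothing from their remainder rows, and one of the
  -- occupied levels lies inside the zone rather than below it, so each of its factors is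
  -- factor + m; later zones are as in prodFrom.
  blockedProd : ℤ → ℕ → List ℕ → ℤ
  blockedProd x i []           = + 1
  blockedProd x i (b ∷ [])     = factor m x i b + + m
  blockedProd x i (b ∷ c ∷ bs) =
    if ⌊ b ⌋[ m ] ℕ.≡ᵇ ⌊ c ⌋[ m ]
    then (factor m x i b + + m) * blockedProd x (suc i) (c ∷ bs)
    else (factor m x i b + + m) * prodFrom m x (suc i) 0 (c ∷ bs)

  prodFrom-sameZone : ∀ x i acc b c bs → ⌊ b ⌋[ m ] ≡ ⌊ c ⌋[ m ] →
    prodFrom m x i acc (b ∷ c ∷ bs) ≡ factor m x i b * prodFrom m x (suc i) (acc ℕ.+ ρ[ m ] b) (c ∷ bs)
  prodFrom-sameZone x i acc b c bs same =
    cong (λ t → if t then factor m x i b * prodFrom m x (suc i) (acc ℕ.+ ρ[ m ] b) (c ∷ bs)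
                     else (factor m x i b + + (acc ℕ.+ ρ[ m ] b)) * prodFrom m x (suc i) 0 (c ∷ bs))
         (dec-true (⌊ b ⌋[ m ] ≟ ⌊ c ⌋[ m ]) same)

  prodFrom-newZone : ∀ x i acc b c bs → ⌊ b ⌋[ m ] ≢ ⌊ c ⌋[ m ] →
    prodFrom m x i acc (b ∷ c ∷ bs) ≡ (factor m x i b + + (acc ℕ.+ ρ[ m ] b)) * prodFrom m x (suc i) 0 (c ∷ bs)
  prodFrom-newZone x i acc b c bs new =
    cong (λ t → if t then factor m x i b * prodFrom m x (suc i) (acc ℕ.+ ρ[ m ] b) (c ∷ bs)
                     else (factor m x i b + + (acc ℕ.+ ρ[ m ] b)) * prodFrom m x (suc i) 0 (c ∷ bs))
         (dec-false (⌊ b ⌋[ m ] ≟ ⌊ c ⌋[ m ]) new)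

  blockedProd-sameZone : ∀ x i b c bs → ⌊ b ⌋[ m ] ≡ ⌊ c ⌋[ m ] →
    blockedProd x i (b ∷ c ∷ bs) ≡ (factor m x i b + + m) * blockedProd x (suc i) (c ∷ bs)
  blockedProd-sameZone x i b c bs same =
    cong (λ t → if t then (factor m x i b + + m) * blockedProd x (suc i) (c ∷ bs)
                     else (factor m x i b + + m) * prodFrom m x (suc i) 0 (c ∷ bs))
         (dec-true (⌊ b ⌋[ m ] ≟ ⌊ c ⌋[ m ]) same)

  blockedProd-newZone : ∀ x i b c bs → ⌊ b ⌋[ m ] ≢ ⌊ c ⌋[ m ] →
    blockedProd x i (b ∷ c ∷ bs) ≡ (factor m x i b + + m) * prodFrom m x (suc i) 0 (c ∷ bs)
  blockedProd-newZone x i b c bs new =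
    cong (λ t → if t then (factor m x i b + + m) * blockedProd x (suc i) (c ∷ bs)
                     else (factor m x i b + + m) * prodFrom m x (suc i) 0 (c ∷ bs))
         (dec-false (⌊ b ⌋[ m ] ≟ ⌊ c ⌋[ m ]) new)

  factor-zone : ∀ x i {b c} → ⌊ b ⌋[ m ] ≡ ⌊ c ⌋[ m ] → factor m x i b ≡ factor m x i c
  factor-zone x i same = cong (λ f → x + + f - + (i ℕ.* m)) same

  factor-shift : ∀ x i b → factor m (x - + m) i b ≡ factor m x (suc i) b
  factor-shift x i b = trans (regroup x (+ m) (+ ⌊ b ⌋[ m ]) (+ (i ℕ.* m)))
                             (cong (λ t → x + + ⌊ b ⌋[ m ] - t) (sym (ℤP.pos-+ m (i ℕ.* m))))
    where regroup : ∀ x M Q I → x - M + Q - I ≡ x + Q - (M + I)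
          regroup = solve-∀

  factor-suc : ∀ x i b → factor m x (suc i) b + + m ≡ factor m x i b
  factor-suc x i b = trans (sym (cong (_+ + m) (factor-shift x i b))) (regroup x (+ m) (+ ⌊ b ⌋[ m ]) (+ (i ℕ.* m)))
    where regroup : ∀ x M Q I → x - M + Q - I + M ≡ x + Q - I
          regroup = solve-∀

  prodFrom-shift : ∀ x i acc B → prodFrom m (x - + m) i acc B ≡ prodFrom m x (suc i) acc B
  prodFrom-shift x i acc []           = refl
  prodFrom-shift x i acc (b ∷ [])     = cong (_+ + (acc ℕ.+ ρ[ m ] b)) (factor-shift x i b)
  prodFrom-shift x i acc (b ∷ c ∷ bs) = if-cong₂ (⌊ b ⌋[ m ] ℕ.≡ᵇ ⌊ c ⌋[ m ])
    (cong₂ _*_ (factor-shift x i b) (prodFrom-shift x (suc i) (acc ℕ.+ ρ[ m ] b) (c ∷ bs)))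
    (cong₂ _*_ (cong (_+ + (acc ℕ.+ ρ[ m ] b)) (factor-shift x i b)) (prodFrom-shift x (suc i) 0 (c ∷ bs)))

  blockedProd-shift : ∀ x i B → blockedProd (x - + m) i B ≡ blockedProd x (suc i) B
  blockedProd-shift x i []           = refl
  blockedProd-shift x i (b ∷ [])     = cong (_+ + m) (factor-shift x i b)
  blockedProd-shift x i (b ∷ c ∷ bs) = if-cong₂ (⌊ b ⌋[ m ] ℕ.≡ᵇ ⌊ c ⌋[ m ])
    (cong₂ _*_ (cong (_+ + m) (factor-shift x i b)) (blockedProd-shift x (suc i) (c ∷ bs)))
    (cong₂ _*_ (cong (_+ + m) (factor-shift x i b)) (prodFrom-shift x (suc i) 0 (c ∷ bs)))

  -- The last factor of a zone is affine in the remainder accumulated in the zone.  After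
  -- multiplying by factor m x i c = factor m x (suc i) c + m, where c is the zone's first
  -- column, the slope telescopes into blockedProd: all factors of the zone are raised by m.
  prodFrom-acc : ∀ x i a d c bs →
    factor m x i c * prodFrom m x (suc i) (a ℕ.+ d) (c ∷ bs) ≡
    factor m x i c * prodFrom m x (suc i) a (c ∷ bs) + + d * blockedProd x (suc i) (c ∷ bs)
  prodFrom-acc x i a d c []
    rewrite ℤP.pos-+ (a ℕ.+ d) (ρ[ m ] c) | ℤP.pos-+ a d | ℤP.pos-+ a (ρ[ m ] c) | sym (factor-suc x i c) =
    affine (factor m x (suc i) c) (+ m) (+ a) (+ d) (+ ρ[ m ] c)
    where affine : ∀ F M a d ρ → (F + M) * (F + (a + d + ρ)) ≡ (F + M) * (F + (a + ρ)) + d * (F + M)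
          affine = solve-∀
  prodFrom-acc x i a d c (c′ ∷ bs) with ⌊ c ⌋[ m ] ≟ ⌊ c′ ⌋[ m ]
  ... | yes same = begin
      A * prodFrom m x (suc i) (a ℕ.+ d) (c ∷ c′ ∷ bs)
    ≡⟨ cong (A *_) (prodFrom-sameZone x (suc i) (a ℕ.+ d) c c′ bs same) ⟩
      A * (F * prodFrom m x (suc (suc i)) (a ℕ.+ d ℕ.+ ρ[ m ] c) (c′ ∷ bs))
    ≡⟨ cong (λ t → A * (F * prodFrom m x (suc (suc i)) t (c′ ∷ bs))) (acc-comm a d (ρ[ m ] c)) ⟩
      A * (F * prodFrom m x (suc (suc i)) (a ℕ.+ ρ[ m ] c ℕ.+ d) (c′ ∷ bs))
    ≡⟨ cong (A *_) (trans (cong (_* prodFrom m x (suc (suc i)) (a ℕ.+ ρ[ m ] c ℕ.+ d) (c′ ∷ bs)) (factor-zone x (suc i) same))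
                   (trans (prodFrom-acc x (suc i) (a ℕ.+ ρ[ m ] c) d c′ bs)
                          (cong (λ f → f * P + + d * Q) (sym (factor-zone x (suc i) same))))) ⟩
      A * (F * P + + d * Q)
    ≡⟨ distribute A F P (+ d) Q ⟩
      A * (F * P) + + d * (A * Q)
    ≡⟨ cong₂ (λ p f → A * p + + d * (f * Q)) (sym (prodFrom-sameZone x (suc i) a c c′ bs same)) (sym (factor-suc x i c)) ⟩
      A * prodFrom m x (suc i) a (c ∷ c′ ∷ bs) + + d * ((F + + m) * Q)
    ≡⟨ cong (λ t → A * prodFrom m x (suc i) a (c ∷ c′ ∷ bs) + + d * t) (sym (blockedProd-sameZone x (suc i) c c′ bs same)) ⟩
      A * prodFrom m x (suc i) a (c ∷ c′ ∷ bs) + + d * blockedProd x (suc i) (c ∷ c′ ∷ bs)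
    ∎
    where
    open ≡-Reasoning
    A F P Q : ℤ
    A = factor m x i c
    F = factor m x (suc i) c
    P = prodFrom m x (suc (suc i)) (a ℕ.+ ρ[ m ] c) (c′ ∷ bs)
    Q = blockedProd x (suc (suc i)) (c′ ∷ bs)
    acc-comm : ∀ a d r → a ℕ.+ d ℕ.+ r ≡ a ℕ.+ r ℕ.+ d
    acc-comm a d r = trans (ℕP.+-assoc a d r) (trans (cong (a ℕ.+_) (ℕP.+-comm d r)) (sym (ℕP.+-assoc a r d)))
    distribute : ∀ A F P d Q → A * (F * P + d * Q) ≡ A * (F * P) + d * (A * Q)
    distribute = solve-∀
  ... | no new
    rewrite prodFrom-newZone x (suc i) (a ℕ.+ d) c c′ bs new | prodFrom-newZone x (suc i) a c c′ bs new
          | blockedProd-newZone x (suc i) c c′ bs new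
          | ℤP.pos-+ (a ℕ.+ d) (ρ[ m ] c) | ℤP.pos-+ a d | ℤP.pos-+ a (ρ[ m ] c) | sym (factor-suc x i c) =
    affine (factor m x (suc i) c) (+ m) (+ a) (+ d) (+ ρ[ m ] c) (prodFrom m x (suc (suc i)) 0 (c′ ∷ bs))
    where affine : ∀ F M a d ρ R → (F + M) * ((F + (a + d + ρ)) * R) ≡ (F + M) * ((F + (a + ρ)) * R) + d * ((F + M) * R)
          affine = solve-∀

module ClosedForm (m : ℕ) .{{_ : NonZero m}} where
  open Placements m
  open Rows m
  open ZoneProducts m

  factor-expand : ∀ x u b → factor m x u b ≡ x + + (b / m) * + m - + u * + m
  factor-expand x u b = cong₂ (λ p q → x + p - q) (ℤP.pos-* (b / m) m) (ℤP.pos-* u m)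

  solve-for : ∀ {s t r} → s + t ≡ r → s ≡ r - t
  solve-for {s} {t} refl = sym (cancel s t)
    where cancel : ∀ s t → s + t - t ≡ s
          cancel = solve-∀

  -- What the first column b contributes when u levels are blocked, given the polynomial V
  -- of the remaining columns with x lowered by m and the polynomial W of the remaining
  -- columns with level b / m blocked: a linear factor, plus the b % m remainder rows of
  -- level b / m when that level is free.
  stepValue : {Occupied : Set} → Dec Occupied → ℤ → ℕ → ℕ → ℤ → ℤ → ℤ
  stepValue (yes _) x u b V W = (factor m x u b + + m) * V
  stepValue (no _)  x u b V W = factor m x u b * V + + (b % m) * W

  -- If blocking any free level below q = b / m acts on the remaining columns as x ↦ x − m,
  -- the first column's rows in full free levels below q all contribute V.
  columnStep : ∀ b B U x → Unique U → All (_≤ b / m) U →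
    (∀ l → l < b / m → l ∉ U → rookPoly B (l ∷ U) x ≡ rookPoly B U (x - + m)) →
    rookPoly (b ∷ B) U x ≡ stepValue (b / m ∈? U) x (length U) b (rookPoly B U (x - + m)) (rookPoly B (b / m ∷ U) x)
  columnStep b B U x uniq U≤q lower = begin
      rookPoly (b ∷ B) U x
    ≡⟨ rookPoly-∷ b B U x ⟩
      x * V + Σℤ b (λ r → G (r / m))
    ≡⟨ cong (_+_ (x * V)) (Σ-rows b G) ⟩
      x * V + (+ m * Σℤ q G + + (b % m) * G q)
    ≡⟨ cong (λ s → x * V + (+ m * s + + (b % m) * G q)) (Σℤ-cong q (λ l l<q → lowLevel l l<q (l ∈? U))) ⟩
      x * V + (+ m * Σℤ q free + + (b % m) * G q)
    ≡⟨ finish (q ∈? U) (freeLevels U q V uniq U≤q) ⟩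
      stepValue (q ∈? U) x (length U) b V (rookPoly B (q ∷ U) x)
    ∎
    where
    open ≡-Reasoning
    q = b / m
    V = rookPoly B U (x - + m)
    G free : ℕ → ℤ
    G l = if does (l ∈? U) then + 0 else rookPoly B (l ∷ U) x
    free l = if does (l ∈? U) then + 0 else V
    lowLevel : ∀ l → l < q → (l∈?U : Dec (l ∈ U)) →
      (if does l∈?U then + 0 else rookPoly B (l ∷ U) x) ≡ (if does l∈?U then + 0 else V)
    lowLevel l l<q (yes _)   = refl
    lowLevel l l<q (no l∉U) = lower l l<q l∉U
    finish : ∀ {S} (q∈?U : Dec (q ∈ U)) → S + + length U * V ≡ + q * V + (if does q∈?U then V else + 0) →
      x * V + (+ m * S + + (b % m) * (if does q∈?U then + 0 else rookPoly B (q ∷ U) x)) ≡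
      stepValue q∈?U x (length U) b V (rookPoly B (q ∷ U) x)
    finish (yes _) count =
      trans (cong (λ s → x * V + (+ m * s + + (b % m) * + 0)) (solve-for count))
        (trans (collect x V (+ q) (+ length U) (+ m) (+ (b % m)))
               (cong (λ f → (f + + m) * V) (sym (factor-expand x (length U) b))))
      where collect : ∀ x V q u M ρ → x * V + (M * (q * V + V - u * V) + ρ * + 0) ≡ (x + q * M - u * M + M) * V
            collect = solve-∀
    finish (no _)  count =
      trans (cong (λ s → x * V + (+ m * s + + (b % m) * W)) (solve-for count))
        (trans (collect x V (+ q) (+ length U) (+ m) (+ (b % m)) W)
               (cong (λ f → f * V + + (b % m) * W) (sym (factor-expand x (length U) b))))
      where W = rookPoly B (q ∷ U) x
            collect : ∀ x V q u M ρ W → x * V + (M * (q * V + + 0 - u * V) + ρ * W) ≡ (x + q * M - u * M) * V + ρ * W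
            collect = solve-∀

  closedForm : Bool → ℤ → ℕ → List ℕ → ℤ
  closedForm true  x i B = blockedProd x i B
  closedForm false x i B = prodFrom m x i 0 B

  closedForm-[] : ∀ f {x i} → closedForm f x i [] ≡ + 1
  closedForm-[] true  = refl
  closedForm-[] false = refl

  closedForm-shift : ∀ f x i B → closedForm f (x - + m) i B ≡ closedForm f x (suc i) B
  closedForm-shift true  x i B = blockedProd-shift x i B
  closedForm-shift false x i B = prodFrom-shift x i 0 B

  lastColumn : ∀ x u b {Occupied} (occupied? : Dec Occupied) →
    stepValue occupied? x u b (+ 1) (+ 1) ≡ closedForm (does occupied?) x u (b ∷ [])
  lastColumn x u b (yes _) = ℤP.*-identityʳ (factor m x u b + + m)
  lastColumn x u b (no _)  = cong₂ _+_ (ℤP.*-identityʳ (factor m x u b)) (ℤP.*-identityʳ (+ (b % m)))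

  sameZone : ∀ x u b c B {Occupied} (occupied? : Dec Occupied) {V W} → ⌊ b ⌋[ m ] ≡ ⌊ c ⌋[ m ] →
    V ≡ closedForm (does occupied?) x (suc u) (c ∷ B) → (¬ Occupied → W ≡ blockedProd x (suc u) (c ∷ B)) →
    stepValue occupied? x u b V W ≡ closedForm (does occupied?) x u (b ∷ c ∷ B)
  sameZone x u b c B (yes _)    same refl _     = sym (blockedProd-sameZone x u b c B same)
  sameZone x u b c B (no free) same refl W≡Q rewrite W≡Q free = sym (begin
      prodFrom m x u 0 (b ∷ c ∷ B)
    ≡⟨ prodFrom-sameZone x u 0 b c B same ⟩
      factor m x u b * prodFrom m x (suc u) (b % m) (c ∷ B)
    ≡⟨ cong (_* prodFrom m x (suc u) (b % m) (c ∷ B)) (factor-zone x u same) ⟩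
      factor m x u c * prodFrom m x (suc u) (b % m) (c ∷ B)
    ≡⟨ prodFrom-acc x u 0 (b % m) c B ⟩
      factor m x u c * prodFrom m x (suc u) 0 (c ∷ B) + + (b % m) * blockedProd x (suc u) (c ∷ B)
    ≡⟨ cong (λ f → f * prodFrom m x (suc u) 0 (c ∷ B) + + (b % m) * blockedProd x (suc u) (c ∷ B))
            (sym (factor-zone x u same)) ⟩
      factor m x u b * prodFrom m x (suc u) 0 (c ∷ B) + + (b % m) * blockedProd x (suc u) (c ∷ B)
    ∎)
    where open ≡-Reasoning

  newZone : ∀ x u b c B {Occupied} (occupied? : Dec Occupied) {V W} → ⌊ b ⌋[ m ] ≢ ⌊ c ⌋[ m ] →
    V ≡ prodFrom m x (suc u) 0 (c ∷ B) → (¬ Occupied → W ≡ prodFrom m x (suc u) 0 (c ∷ B)) →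
    stepValue occupied? x u b V W ≡ closedForm (does occupied?) x u (b ∷ c ∷ B)
  newZone x u b c B (yes _)    new refl _ = sym (blockedProd-newZone x u b c B new)
  newZone x u b c B (no free) new refl W≡P rewrite W≡P free =
    sym (trans (prodFrom-newZone x u 0 b c B new) (ℤP.*-distribʳ-+ (prodFrom m x (suc u) 0 (c ∷ B)) (factor m x u b) (+ (b % m))))

  headLevel : List ℕ → ℕ
  headLevel []      = 0
  headLevel (b ∷ _) = b / m

  ClosedFormHolds : List ℕ → Set
  ClosedFormHolds B = ∀ U → Unique U → All (_≤ headLevel B) U → ∀ x →
    rookPoly B U x ≡ closedForm (does (headLevel B ∈? U)) x (length U) B

  lowerX : ∀ {c B} → ClosedFormHolds (c ∷ B) → ∀ U x → Unique U → All (_≤ c / m) U →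
    rookPoly (c ∷ B) U (x - + m) ≡ closedForm (does (c / m ∈? U)) x (suc (length U)) (c ∷ B)
  lowerX {c} {B} closed U x uniq U≤ =
    trans (closed U uniq U≤ (x - + m)) (closedForm-shift (does (c / m ∈? U)) x (length U) (c ∷ B))

  blockLevel : ∀ {c B} → ClosedFormHolds (c ∷ B) → ∀ U l x → Unique U → All (_≤ c / m) U → l ∉ U → l ≤ c / m →
    rookPoly (c ∷ B) (l ∷ U) x ≡ closedForm (does (c / m ≟ l) ∨ does (c / m ∈? U)) x (suc (length U)) (c ∷ B)
  blockLevel closed U l x uniq U≤ l∉U l≤ = closed (l ∷ U) (AllP.¬Any⇒All¬ U l∉U ∷ uniq) (l≤ ∷ U≤) x

  blockBelow : ∀ {c B} → ClosedFormHolds (c ∷ B) → ∀ U x → Unique U → All (_≤ c / m) U →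
    ∀ l → l < c / m → l ∉ U → rookPoly (c ∷ B) (l ∷ U) x ≡ rookPoly (c ∷ B) U (x - + m)
  blockBelow {c} {B} closed U x uniq U≤ l l< l∉U =
    trans (blockLevel closed U l x uniq U≤ l∉U (ℕP.<⇒≤ l<))
      (trans (cong (λ t → closedForm (t ∨ does (c / m ∈? U)) x (suc (length U)) (c ∷ B))
                   (dec-false (c / m ≟ l) (ℕP.<⇒≢ l< ∘ sym)))
             (sym (lowerX closed U x uniq U≤)))

  above-∉ : ∀ {U q n} → All (_≤ q) U → q < n → n ∉ U
  above-∉ U≤q q<n n∈U = ℕP.<⇒≱ q<n (All.lookup U≤q n∈U)

  rookPoly-closed : ∀ B → Linked _≤_ B → ClosedFormHolds B
  rookPoly-closed []          _ U uniq U≤q x = sym (closedForm-[] (does (0 ∈? U)))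
  rookPoly-closed (b ∷ [])    _ U uniq U≤q x =
    trans (columnStep b [] U x uniq U≤q (λ _ _ _ → refl)) (lastColumn x (length U) b (b / m ∈? U))
  rookPoly-closed (b ∷ c ∷ B) (b≤c ∷ sorted) U uniq U≤q x =
    trans (columnStep b (c ∷ B) U x uniq U≤q (λ l l<q → blockBelow closed U x uniq U≤qc l (ℕP.<-≤-trans l<q q≤qc)))
          (joinZones (b / m ≟ c / m))
    where
    closed : ClosedFormHolds (c ∷ B)
    closed = rookPoly-closed (c ∷ B) sorted
    u = length U
    q≤qc : b / m ≤ c / m
    q≤qc = /-monoˡ-≤ m b≤c
    U≤qc : All (_≤ c / m) U
    U≤qc = All.map (λ l≤q → ℕP.≤-trans l≤q q≤qc) U≤q
    joinZones : Dec (b / m ≡ c / m) →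
      stepValue (b / m ∈? U) x u b (rookPoly (c ∷ B) U (x - + m)) (rookPoly (c ∷ B) (b / m ∷ U) x) ≡
      closedForm (does (b / m ∈? U)) x u (b ∷ c ∷ B)
    joinZones (yes q≡qc) = sameZone x u b c B (b / m ∈? U) (cong (ℕ._* m) q≡qc)
      (trans (lowerX closed U x uniq U≤qc) (cong (λ l → closedForm (does (l ∈? U)) x (suc u) (c ∷ B)) (sym q≡qc)))
      (λ q∉U → trans (blockLevel closed U (b / m) x uniq U≤qc q∉U q≤qc)
                     (cong (λ t → closedForm (t ∨ does (c / m ∈? U)) x (suc u) (c ∷ B)) (dec-true (c / m ≟ b / m) (sym q≡qc))))
    joinZones (no q≢qc) = newZone x u b c B (b / m ∈? U) (q≢qc ∘ ℕP.*-cancelʳ-≡ (b / m) (c / m) m)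
      (trans (lowerX closed U x uniq U≤qc) (cong (λ t → closedForm t x (suc u) (c ∷ B)) (dec-false (c / m ∈? U) (above-∉ U≤q q<qc))))
      (λ q∉U → trans (blockLevel closed U (b / m) x uniq U≤qc q∉U q≤qc)
                     (cong (λ t → closedForm t x (suc u) (c ∷ B)) (dec-false (c / m ∈? b / m ∷ U) (above-∉ (ℕP.≤-refl ∷ U≤q) q<qc))))
      where q<qc = ℕP.≤∧≢⇒< q≤qc q≢qc

theorem2p1 : (m : ℕ) → .{{_ : NonZero m}} → (B : List ℕ) → Linked _≤_ B →
    (x : ℤ) → lhs m B x ≡ rhs m B x
theorem2p1 m B sorted x = begin
    lhs m B x
  ≡⟨ lhs≡rookPoly B x ⟩
    rookPoly B [] x
  ≡⟨ rookPoly-closed B sorted [] [] [] x ⟩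
    rhs m B x
  ∎
  where
  open ≡-Reasoning
  open Placements m
  open ClosedForm m
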